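{- In the setting described in the context, for every facet $\tau$ of $\Lambda$, $|\mathbf{V}[\tau]|-|\tau[0]|=\left(\sum_{i=1}^m a_i\right)-d$.
   Context: Let $\mathbf{V}=\mathbf{V}_1\cup\cdots\cup\mathbf{V}_m$ (pairwise disjoint finite sets), $\mathbf{a}=(a_1,\ldots,a_m)$ nonnegative integers with $a_i\le|\mathbf{V}_i|$, and $1\le d\le\sum_i a_i$. $\Lambda$ is the simplicial complex on $\mathbf{V}$ whose faces are the $\tau\subseteq\mathbf{V}$ with $|\tau\cap\mathbf{V}_i|\le a_i$ for all $i$ and $|\tau|\le d$; facets are faces of size $d$. Write $\mathbf{V}_i=\{v^i_1\succ v^i_2\succ\cdots\}$ and let $\mathbf{X}_i=\{x^i_1\succ x^i_2\succ\cdots\succ x^i_{|\mathbf{V}_i|-a_i}\}$ be variables. For a finite totally ordered set $V=\{v_1\succ\cdots\succ v_N\}$, an integer $0\le a\le N$ and variables $X=\{x_1\succ\cdots\succ x_{N-a}\}$, define $\phi(V,X)$ on $a$-subsets $\tau$ of $V$: write $\tau=\{v_1,\ldots,v_t,v_{i_1},\ldots,v_{i_s}\}$ with $t+s=a$, $t+1<i_1<\cdots<i_s$, and set $\phi(V,X)(\tau)=x_{i_1-(t+1)}\cdots x_{i_s-(t+s)}$. For a facet $\tau$ and $1\le i\le m$, let $\mathrm{fill}_i(\tau)$ be the revlex-first $a_i$-subset of $\mathbf{V}_i$ containing $\tau\cap\mathbf{V}_i$ (i.e. $\tau\cap\mathbf{V}_i$ together with the $\succ$-first $a_i-|\tau\cap\mathbf{V}_i|$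 elements of $\mathbf{V}_i-\tau$), and $\Phi_i(\tau)=\phi(\mathbf{V}_i,\mathbf{X}_i)(\mathrm{fill}_i(\tau))$. Let $\mathbf{V}[\tau]$ be the subset of $\mathbf{V}$ consisting of the $\succ$-first $a_i-\deg\Phi_i(\tau)$ elements of $\mathbf{V}_i$ for each $1\le i\le m$, and $\tau[0]=\tau\cap\mathbf{V}[\tau]$. -}

module Defs where

open import Data.Nat using (ℕ; zero; suc; _+_; _∸_; _<ᵇ_; _≤_)
open import Data.Bool using (Bool; true; false)
open import Data.Fin using (Fin; toℕ)
open import Data.Fin.Subset using (Subset; ∣_∣; _∩_)
open import Data.List using (List; []; _∷_; drop; zipWith; applyUpTo; length)
open import Data.Vec using (Vec; []; _∷_; tabulate; sum)
open import Data.Product using (_×_)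
open import Relation.Binary.PropositionalEquality using (_≡_)

-- Conventions: a totally ordered set V = {v_1 ≻ v_2 ≻ ... ≻ v_N} is
-- represented by Fin N, where index j (0-based) stands for v_{j+1};
-- subsets are Data.Fin.Subset (Vec Bool N, true = inside).

Σ[_] : {m : ℕ} → (Fin m → ℕ) → ℕ
Σ[ f ] = sum (tabulate f)

positionsFrom : {n : ℕ} → ℕ → Vec Bool n → List ℕ
positionsFrom p [] = []
positionsFrom p (true ∷ xs) = p ∷ positionsFrom (suc p) xs
positionsFrom p (false ∷ xs) = positionsFrom (suc p) xs

positions : {n : ℕ} → Vec Bool n → List ℕ
positions = positionsFrom 1

initRun : {n : ℕ} → Vec Bool n → ℕ
initRun [] = 0
initRun (true ∷ xs) = suc (initRun xs)
initRun (false ∷ xs) = 0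

-- A monomial in the variables x_1, x_2, ... is represented by the list of
-- indices of its factors (with multiplicity); its degree is the length.
Monomial : Set
Monomial = List ℕ

deg : Monomial → ℕ
deg = length

-- φ(V,X)(σ) = x_{i_1-(t+1)} ⋯ x_{i_s-(t+s)}  where
-- σ = {v_1,…,v_t, v_{i_1},…,v_{i_s}},  t+1 < i_1 < ⋯ < i_s.
phi : {n : ℕ} → Subset n → Monomial
phi σ = zipWith (λ i k → i ∸ (t + k)) is (applyUpTo suc (length is))
  where
  t = initRun σ
  is = drop t (positions σ)

fillWith : {n : ℕ} → ℕ → Subset n → Subset n
fillWith k [] = []
fillWith k (true ∷ xs) = true ∷ fillWith k xs
fillWith zero (false ∷ xs) = false ∷ fillWith zero xs
fillWith (suc k) (false ∷ xs) = true ∷ fillWith k xs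

firstK : {n : ℕ} → ℕ → Subset n
firstK k = tabulate (λ j → toℕ j <ᵇ k)

module Setting {m : ℕ} (N a : Fin m → ℕ) where

  -- a subset τ of V = V_1 ⊔ ⋯ ⊔ V_m, given by its parts τ ∩ V_i
  SubsetV : Set
  SubsetV = (i : Fin m) → Subset (N i)

  card : SubsetV → ℕ
  card τ = Σ[ (λ i → ∣ τ i ∣) ]

  IsFacet : ℕ → SubsetV → Set
  IsFacet d τ = ((i : Fin m) → ∣ τ i ∣ ≤ a i) × card τ ≡ d

  fill : SubsetV → (i : Fin m) → Subset (N i)
  fill τ i = fillWith (a i ∸ ∣ τ i ∣) (τ i)

  Φ : SubsetV → Fin m → Monomial
  Φ τ i = phi (fill τ i)

  V[_] : SubsetV → SubsetV
  V[ τ ] i = firstK (a i ∸ deg (Φ τ i))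

  _[0] : SubsetV → SubsetV
  (τ [0]) i = τ i ∩ V[ τ ] i

-- In each block V_i, fill_i(τ) consists of τ ∩ V_i plus k_i = a_i − |τ ∩ V_i| new
-- elements, and deg Φ_i(τ) = a_i − t_i where t_i is the length of the initial run
-- of fill_i(τ).  Thus V[τ] ∩ V_i is that initial run.  Since the filling picks the
-- ≻-first missing elements, all k_i new elements lie in the run, so
-- |V[τ] ∩ V_i| = |τ[0] ∩ V_i| + k_i.  Summing over i, and using Σ k_i = Σ a_i − d
-- for a facet, gives the claim.
module Submission where

open import Defs
open import Data.Nat using (ℕ; zero; suc; _+_; _∸_; _≤_; z≤n; s≤s)
open import Data.Nat.Properties
open import Data.Bool using (true; false)
open import Data.Fin using (Fin) renaming (zero to fzero; suc to fsuc)
open import Data.Fin.Subset using (Subset; ∣_∣; _∩_; ⊥)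
open import Data.Fin.Subset.Properties using (∣⊥∣≡0; ∣p∣≤n; ∩-zeroʳ)
open import Data.Vec using (_∷_; []; sum)
open import Data.Vec.Properties using (tabulate-cong)
open import Data.List using (drop; applyUpTo; length)
open import Data.List.Properties using (length-zipWith; length-applyUpTo; length-drop)
open import Data.Integer using (+_; _-_; _⊖_)
open import Data.Integer.Properties using ([+m]-[+n]≡m⊖n; ⊖-≥)
open import Data.Product using (_,_)
open import Algebra.Properties.CommutativeSemigroup +-commutativeSemigroup using (interchange)
open import Relation.Binary.PropositionalEquality
  using (_≡_; refl; sym; trans; cong; module ≡-Reasoning)

Σ-cong : ∀ {m} {f g : Fin m → ℕ} → (∀ i → f i ≡ g i) → Σ[ f ] ≡ Σ[ g ]
Σ-cong f≗g = cong sum (tabulate-cong f≗g)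

Σ-distrib-+ : ∀ {m} (f g : Fin m → ℕ) → Σ[ (λ i → f i + g i) ] ≡ Σ[ f ] + Σ[ g ]
Σ-distrib-+ {zero} f g = refl
Σ-distrib-+ {suc m} f g = begin
  f fzero + g fzero + Σ[ (λ i → f (fsuc i) + g (fsuc i)) ]
    ≡⟨ cong (λ s → f fzero + g fzero + s) (Σ-distrib-+ (λ i → f (fsuc i)) (λ i → g (fsuc i))) ⟩
  f fzero + g fzero + (Σ[ (λ i → f (fsuc i)) ] + Σ[ (λ i → g (fsuc i)) ])
    ≡⟨ interchange (f fzero) (g fzero) _ _ ⟩
  f fzero + Σ[ (λ i → f (fsuc i)) ] + (g fzero + Σ[ (λ i → g (fsuc i)) ]) ∎
  where open ≡-Reasoning

+[m+n]-+m≡+n : ∀ m n → + (m + n) - + m ≡ + n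
+[m+n]-+m≡+n m n = begin
  + (m + n) - + m  ≡⟨ [+m]-[+n]≡m⊖n (m + n) m ⟩
  (m + n) ⊖ m      ≡⟨ ⊖-≥ (m≤m+n m n) ⟩
  + (m + n ∸ m)    ≡⟨ cong +_ (m+n∸m≡n m n) ⟩
  + n ∎
  where open ≡-Reasoning

m+suc[k]≤suc[n]⇒m+k≤n : ∀ {m k n} → m + suc k ≤ suc n → m + k ≤ n
m+suc[k]≤suc[n]⇒m+k≤n {m} {k} h = ≤-pred (≤-trans (≤-reflexive (sym (+-suc m k))) h)

length-positionsFrom : ∀ {n} p (σ : Subset n) → length (positionsFrom p σ) ≡ ∣ σ ∣
length-positionsFrom p []          = refl
length-positionsFrom p (true ∷ σ)  = cong suc (length-positionsFrom (suc p) σ)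
length-positionsFrom p (false ∷ σ) = length-positionsFrom (suc p) σ

initRun≤∣σ∣ : ∀ {n} (σ : Subset n) → initRun σ ≤ ∣ σ ∣
initRun≤∣σ∣ []          = z≤n
initRun≤∣σ∣ (true ∷ σ)  = s≤s (initRun≤∣σ∣ σ)
initRun≤∣σ∣ (false ∷ σ) = z≤n

deg-phi : ∀ {n} (σ : Subset n) → deg (phi σ) ≡ ∣ σ ∣ ∸ initRun σ
deg-phi σ = begin
  deg (phi σ)                         ≡⟨ length-zipWith _ is (applyUpTo suc (length is)) ⟩
  length is ⊓ length (applyUpTo suc (length is))
                                      ≡⟨ cong (length is ⊓_) (length-applyUpTo suc (length is)) ⟩
  length is ⊓ length is               ≡⟨ ⊓-idem (length is) ⟩
  length is                           ≡⟨ length-drop (initRun σ) (positions σ) ⟩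
  length (positions σ) ∸ initRun σ    ≡⟨ cong (_∸ initRun σ) (length-positionsFrom 1 σ) ⟩
  ∣ σ ∣ ∸ initRun σ ∎
  where
  open ≡-Reasoning
  open Data.Nat using (_⊓_)
  is = drop (initRun σ) (positions σ)

firstK-zero : ∀ {n} → firstK {n} 0 ≡ ⊥
firstK-zero {zero}  = refl
firstK-zero {suc n} = cong (false ∷_) firstK-zero

∣firstK∣ : ∀ {n} k → k ≤ n → ∣ firstK {n} k ∣ ≡ k
∣firstK∣ {n}     zero    _       = trans (cong ∣_∣ (firstK-zero {n})) (∣⊥∣≡0 n)
∣firstK∣ {suc n} (suc k) (s≤s h) = cong suc (∣firstK∣ k h)

∣σ∩firstK-zero∣ : ∀ {n} (σ : Subset n) → ∣ σ ∩ firstK 0 ∣ ≡ 0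
∣σ∩firstK-zero∣ {n} σ = begin
  ∣ σ ∩ firstK 0 ∣  ≡⟨ cong (λ ρ → ∣ σ ∩ ρ ∣) firstK-zero ⟩
  ∣ σ ∩ ⊥ ∣         ≡⟨ cong ∣_∣ (∩-zeroʳ σ) ⟩
  ∣ ⊥ {n} ∣         ≡⟨ ∣⊥∣≡0 n ⟩
  0 ∎
  where open ≡-Reasoning

fillWith-zero : ∀ {n} (σ : Subset n) → fillWith 0 σ ≡ σ
fillWith-zero []          = refl
fillWith-zero (true ∷ σ)  = cong (true ∷_) (fillWith-zero σ)
fillWith-zero (false ∷ σ) = cong (false ∷_) (fillWith-zero σ)

∣fillWith∣ : ∀ {n} (σ : Subset n) k → ∣ σ ∣ + k ≤ n → ∣ fillWith k σ ∣ ≡ ∣ σ ∣ + k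
∣fillWith∣ []          zero    _       = refl
∣fillWith∣ (true ∷ σ)  k       (s≤s h) = cong suc (∣fillWith∣ σ k h)
∣fillWith∣ (false ∷ σ) zero    _       = trans (cong ∣_∣ (fillWith-zero σ)) (sym (+-identityʳ ∣ σ ∣))
∣fillWith∣ (false ∷ σ) (suc k) h       =
  trans (cong suc (∣fillWith∣ σ k (m+suc[k]≤suc[n]⇒m+k≤n h))) (sym (+-suc ∣ σ ∣ k))

-- Every added element falls in the initial run: while elements remain to be
-- added, a gap of σ is filled, so the run can only stop once k is used up.
∣σ∩initRun[fillWith]∣ : ∀ {n} (σ : Subset n) k → ∣ σ ∣ + k ≤ n →
  ∣ σ ∩ firstK (initRun (fillWith k σ)) ∣ + k ≡ initRun (fillWith k σ)
∣σ∩initRun[fillWith]∣ []          zero    _       = refl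
∣σ∩initRun[fillWith]∣ (true ∷ σ)  k       (s≤s h) = cong suc (∣σ∩initRun[fillWith]∣ σ k h)
∣σ∩initRun[fillWith]∣ (false ∷ σ) zero    _       = trans (+-identityʳ _) (∣σ∩firstK-zero∣ σ)
∣σ∩initRun[fillWith]∣ (false ∷ σ) (suc k) h       =
  trans (+-suc _ k) (cong suc (∣σ∩initRun[fillWith]∣ σ k (m+suc[k]≤suc[n]⇒m+k≤n h)))

∣firstK∣-excess : ∀ {n} (σ : Subset n) a → ∣ σ ∣ ≤ a → a ≤ n →
  let t = a ∸ deg (phi (fillWith (a ∸ ∣ σ ∣) σ)) in
  ∣ firstK {n} t ∣ ≡ ∣ σ ∩ firstK t ∣ + (a ∸ ∣ σ ∣)
∣firstK∣-excess {n} σ a σ≤a a≤n = begin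
  ∣ firstK {n} (a ∸ deg (phi F)) ∣  ≡⟨ cong (λ t → ∣ firstK {n} t ∣) a∸deg≡run ⟩
  ∣ firstK {n} run ∣                ≡⟨ ∣firstK∣ run (≤-trans (initRun≤∣σ∣ F) (∣p∣≤n F)) ⟩
  run                               ≡⟨ sym (∣σ∩initRun[fillWith]∣ σ k σ+k≤n) ⟩
  ∣ σ ∩ firstK run ∣ + k            ≡⟨ cong (λ t → ∣ σ ∩ firstK t ∣ + k) (sym a∸deg≡run) ⟩
  ∣ σ ∩ firstK (a ∸ deg (phi F)) ∣ + k ∎
  where
  open ≡-Reasoning
  k = a ∸ ∣ σ ∣
  F = fillWith k σ
  run = initRun F
  σ+k≡a : ∣ σ ∣ + k ≡ a
  σ+k≡a = m+[n∸m]≡n σ≤a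
  σ+k≤n : ∣ σ ∣ + k ≤ n
  σ+k≤n = ≤-trans (≤-reflexive σ+k≡a) a≤n
  ∣F∣≡a : ∣ F ∣ ≡ a
  ∣F∣≡a = trans (∣fillWith∣ σ k σ+k≤n) σ+k≡a
  a∸deg≡run : a ∸ deg (phi F) ≡ run
  a∸deg≡run = begin
    a ∸ deg (phi F)     ≡⟨ cong (a ∸_) (trans (deg-phi F) (cong (_∸ run) ∣F∣≡a)) ⟩
    a ∸ (a ∸ run)       ≡⟨ m∸[m∸n]≡n (≤-trans (initRun≤∣σ∣ F) (≤-reflexive ∣F∣≡a)) ⟩
    run ∎

lemma6p3 : (m : ℕ) (N a : Fin m → ℕ) → ((i : Fin m) → a i ≤ N i) →
    (d : ℕ) → 1 ≤ d → d ≤ Σ[ a ] →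
    (τ : Setting.SubsetV N a) → Setting.IsFacet N a d τ →
    (+ Setting.card N a (Setting.V[_] N a τ)) - (+ Setting.card N a (Setting._[0] N a τ))
      ≡ (+ Σ[ a ]) - (+ d)
lemma6p3 m N a a≤N d _ _ τ (τ≤a , card≡d) = begin
  + card V[ τ ] - + card (τ [0])             ≡⟨ cong (λ x → + x - + card (τ [0])) card-V[τ] ⟩
  + (card (τ [0]) + Σ[ k ]) - + card (τ [0]) ≡⟨ +[m+n]-+m≡+n (card (τ [0])) Σ[ k ] ⟩
  + Σ[ k ]                                   ≡⟨ sym (+[m+n]-+m≡+n d Σ[ k ]) ⟩
  + (d + Σ[ k ]) - + d                       ≡⟨ cong (λ x → + x - + d) (sym Σa≡d+Σk) ⟩
  + Σ[ a ] - + d ∎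
  where
  open ≡-Reasoning
  open Setting N a
  k : Fin m → ℕ
  k i = a i ∸ ∣ τ i ∣
  card-V[τ] : card V[ τ ] ≡ card (τ [0]) + Σ[ k ]
  card-V[τ] = trans (Σ-cong (λ i → ∣firstK∣-excess (τ i) (a i) (τ≤a i) (a≤N i)))
                    (Σ-distrib-+ (λ i → ∣ (τ [0]) i ∣) k)
  Σa≡d+Σk : Σ[ a ] ≡ d + Σ[ k ]
  Σa≡d+Σk = begin
    Σ[ a ]                           ≡⟨ Σ-cong (λ i → sym (m+[n∸m]≡n (τ≤a i))) ⟩
    Σ[ (λ i → ∣ τ i ∣ + k i) ]       ≡⟨ Σ-distrib-+ (λ i → ∣ τ i ∣) k ⟩
    card τ + Σ[ k ]                  ≡⟨ cong (_+ Σ[ k ]) card≡d ⟩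
    d + Σ[ k ] ∎
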